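{- Let $A$ be a linear diagram with $n\ge 2$ vertices and let $r:A=D_0\to_R D_1\to_R\cdots\to_R D_k=B$ be a funnel such that $A$ or $B$ is collapsible. Then for every non-final vertex $u$, the sequence of heights of $u$ in $D_0,D_1,\dots,D_k$ is monotone (non-decreasing or non-increasing).
   Context: A diagram is a tuple $D=(S,N,H,I,O)$, $S,N\in\mathbb N$, $H,I,O:\{0,\dots,N-1\}\to\mathbb N$; $\Delta(n)=O(n)-I(n)$, $W(0)=S$, $W(n+1)=W(n)+\Delta(n)$; valid if $W(n)\ge H(n)+I(n)$ for all $n$. The vertex at height $n$ (heights numbered top to bottom) has as inputs the wires $H(n),\dots,H(n)+I(n)-1$ among the $W(n)$ wires crossing level $n$ (numbered left to right) and as outputs wires $H(n),\dots,H(n)+O(n)-1$ of level $n+1$; wire $k<H(n)$ of level $n$ continues as wire $k$ of level $n+1$, wire $k\ge H(n)+I(n)$ continues as wire $k+\Delta(n)$. Edges are the resulting maximal wire chains; the underlying graph has the vertices of $D$ as vertices and the edges joining two vertices as edges. A right exchange at height $n$ ($0\le n\le N-2$) is admissible when $H(n+1)\ge H(n)+O(n)$ and produces the diagram identical to $D$ except $H'(n)=H(n+1)-\Delta(n)$, $I'(n)=I(n+1)$, $O'(n)=O(n+1)$, $H'(n+1)=H(n)$, $I'(n+1)=I(n)$, $O'(n+1)=O(n)$; it swaps the heights of the two vertices at heights $n,n+1$ (we say it exchanges them), vertices keeping their identity. A reduction $A\to_R^*B$ is a finite sequence of right exchanges. A linear diagram is a valid diagram whose underlying graph is connected, acyclic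 and has exactly two leaves (vertices incident to only one edge); its vertices are numbered $1,\dots,n$ (with a fixed choice of direction) so that $1$ and $n$ are the leaves and $k$ is adjacent to $k-1$ and $k+1$ for $1<k<n$. The final vertices are $n-1$ and $n$; the others are non-final. The final interval of a diagram is the set of vertices whose height lies between the heights of the two final vertices, inclusive; the diagram is collapsible if its final interval consists of the final vertices only. A reduction is a funnel if (i) each non-final vertex is exchanged at most once with a final vertex, and (ii) whenever an exchange involves two non-final vertices $u,v$, both $u$ and $v$ are exchanged with a final vertex in the course of the reduction, and these two final vertices are different. -}

module Defs where

open import Data.Nat using (ℕ; zero; suc; _+_; _∸_; _≤_; _<_; _<?_; _≟_)
open import Data.Bool using (Bool; if_then_else_)
open import Data.Maybe using (Maybe; just; nothing)
open import Data.List using (List; []; _∷_; take; length)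
open import Data.Product using (Σ; ∃; _×_; _,_; proj₁)
open import Data.Sum using (_⊎_)
open import Data.Unit using (⊤)
open import Data.Empty using (⊥)
open import Relation.Nullary using (¬_; yes; no)
open import Relation.Nullary.Decidable using (⌊_⌋)
open import Relation.Binary.PropositionalEquality using (_≡_; _≢_)

-- Diagrams D = (S, N, H, I, O).  H, I, O are given as functions ℕ → ℕ;
-- only their values at 0 … N-1 are ever used.

record Diagram : Set where
  field
    S N : ℕ
    H I O : ℕ → ℕ
open Diagram public

-- W(0) = S, W(n+1) = W(n) + O(n) - I(n).  (Truncated subtraction: as
-- long as W(m) ≥ H(m)+I(m) for all m < n, W(n) is computed exactly, so
-- the validity predicate below is unaffected.)
W : Diagram → ℕ → ℕ
W D zero = S D
W D (suc n) = (W D n + O D n) ∸ I D n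

Valid : Diagram → Set
Valid D = ∀ n → n < N D → H D n + I D n ≤ W D n

-- Following wires downward.  `go D f m k` follows wire k of level m
-- through the vertices at heights m, m+1, …, m+f-1 and returns the
-- height of the vertex having it as an input (nothing if it reaches
-- the bottom).

go : Diagram → ℕ → ℕ → ℕ → Maybe ℕ
go D zero m k = nothing
go D (suc f) m k with k <? H D m | k <? H D m + I D m
... | yes _ | _     = go D f (suc m) k
... | no _  | yes _ = just m
... | no _  | no _  = go D f (suc m) ((k + O D m) ∸ I D m)

target : Diagram → ℕ → ℕ → Maybe ℕ
target D m k = go D (N D ∸ m) m k

-- An edge of the underlying graph is identified by the output slot
-- (s , j) where its wire chain starts: wire j of level s+1, an output
-- of the vertex at height s.
EdgeId : Set
EdgeId = ℕ × ℕ

IsEdge : Diagram → EdgeId → ℕ → Set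
IsEdge D (s , j) t =
  s < N D × H D s ≤ j × j < H D s + O D s × target D (suc s) j ≡ just t

Joins : Diagram → EdgeId → ℕ → ℕ → Set
Joins D e a b = ∃ λ t → IsEdge D e t ×
  ((proj₁ e ≡ a × t ≡ b) ⊎ (proj₁ e ≡ b × t ≡ a))

Adjacent : Diagram → ℕ → ℕ → Set
Adjacent D a b = ∃ λ e → Joins D e a b

Incident : Diagram → EdgeId → ℕ → Set
Incident D e v = ∃ λ w → Joins D e v w

data Walk (D : Diagram) : ℕ → ℕ → Set where
  here : ∀ {a} → Walk D a a
  step : ∀ {a b c} → Adjacent D a b → Walk D b c → Walk D a c

Connected : Diagram → Set
Connected D = ∀ a b → a < N D → b < N D → Walk D a b

Cycle : Diagram → Set
Cycle D = Σ ℕ λ m → 0 < m × Σ (ℕ → ℕ) λ v → Σ (ℕ → EdgeId) λ e →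
  (∀ i j → i < m → j < m → v i ≡ v j → i ≡ j) ×
  (∀ i j → i < m → j < m → e i ≡ e j → i ≡ j) ×
  (∀ i → i < m → Joins D (e i) (v i) (v (if ⌊ suc i ≟ m ⌋ then 0 else suc i)))

Acyclic : Diagram → Set
Acyclic D = ¬ Cycle D

Leaf : Diagram → ℕ → Set
Leaf D v = v < N D × (∃ λ e → Incident D e v) ×
  (∀ e e′ → Incident D e v → Incident D e′ v → e ≡ e′)

ExactlyTwoLeaves : Diagram → Set
ExactlyTwoLeaves D = Σ ℕ λ a → Σ ℕ λ b → a ≢ b × Leaf D a × Leaf D b ×
  (∀ v → Leaf D v → v ≡ a ⊎ v ≡ b)

IsLinear : Diagram → Set
IsLinear D = Valid D × Connected D × Acyclic D × ExactlyTwoLeaves D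

-- A numbering of the vertices of a linear diagram along the path:
-- position p (0-based, p = 0 … N-1, i.e. paper's number p+1) is the
-- vertex (height in D) ν p.
record PathNumbering (D : Diagram) (ν : ℕ → ℕ) : Set where
  field
    inRange  : ∀ p → p < N D → ν p < N D
    injective : ∀ p q → p < N D → q < N D → ν p ≡ ν q → p ≡ q
    firstLeaf : Leaf D (ν 0)
    lastLeaf  : Leaf D (ν (N D ∸ 1))
    adjacent  : ∀ p → suc p < N D → Adjacent D (ν p) (ν (suc p))

Admissible : Diagram → ℕ → Set
Admissible D n = suc (suc n) ≤ N D × H D n + O D n ≤ H D (suc n)

upd : ℕ → ℕ → ℕ → (ℕ → ℕ) → (ℕ → ℕ)
upd n a b f m =
  if ⌊ m ≟ n ⌋ then a else (if ⌊ m ≟ suc n ⌋ then b else f m)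

rex : Diagram → ℕ → Diagram
rex D n = record
  { S = S D ; N = N D
  ; H = upd n ((H D (suc n) + I D n) ∸ O D n) (H D n) (H D)
  ; I = upd n (I D (suc n)) (I D n) (I D)
  ; O = upd n (O D (suc n)) (O D n) (O D) }

-- a reduction starting at D is given by the list of heights at which the
-- successive right exchanges take place, each admissible
run : Diagram → List ℕ → Diagram
run D [] = D
run D (n ∷ ns) = run (rex D n) ns

AdmissibleSeq : Diagram → List ℕ → Set
AdmissibleSeq D [] = ⊤
AdmissibleSeq D (n ∷ ns) = Admissible D n × AdmissibleSeq (rex D n) ns

stage : Diagram → List ℕ → ℕ → Diagram
stage D ns i = run D (take i ns)

-- vertices are identified with their heights in the initial diagram
-- D_0; an exchange at height n swaps heights n and n+1.
swapAt : ℕ → ℕ → ℕ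
swapAt n x = if ⌊ x ≟ n ⌋ then suc n else (if ⌊ x ≟ suc n ⌋ then n else x)

posAfter : List ℕ → ℕ → ℕ
posAfter [] u = u
posAfter (n ∷ ns) u = posAfter ns (swapAt n u)

height : List ℕ → ℕ → ℕ → ℕ
height ns i u = posAfter (take i ns) u

lookupℕ : List ℕ → ℕ → ℕ
lookupℕ [] i = 0
lookupℕ (x ∷ xs) zero = x
lookupℕ (x ∷ xs) (suc i) = lookupℕ xs i

Involved : List ℕ → ℕ → ℕ → Set
Involved ns i u = height ns i u ≡ lookupℕ ns i ⊎ height ns i u ≡ suc (lookupℕ ns i)

Exchanges : ℕ → List ℕ → ℕ → ℕ → ℕ → Set
Exchanges N ns i u v =
  i < length ns × u < N × v < N × u ≢ v × Involved ns i u × Involved ns i v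

IsFinal : ℕ → (ℕ → ℕ) → ℕ → Set
IsFinal N ν u = u ≡ ν (N ∸ 2) ⊎ u ≡ ν (N ∸ 1)

NonFinal : ℕ → (ℕ → ℕ) → ℕ → Set
NonFinal N ν u = u < N × ¬ IsFinal N ν u

Between : ℕ → ℕ → ℕ → Set
Between a b x = (a ≤ x × x ≤ b) ⊎ (b ≤ x × x ≤ a)

CollapsibleAt : ℕ → (ℕ → ℕ) → List ℕ → ℕ → Set
CollapsibleAt N ν ns i = ∀ w → w < N →
  Between (height ns i (ν (N ∸ 2))) (height ns i (ν (N ∸ 1))) (height ns i w) →
  IsFinal N ν w

Funnel : ℕ → (ℕ → ℕ) → List ℕ → Set
Funnel N ν ns =
  (∀ u i j f f′ → NonFinal N ν u → IsFinal N ν f → IsFinal N ν f′ →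
     Exchanges N ns i u f → Exchanges N ns j u f′ → i ≡ j) ×
  (∀ i u v → NonFinal N ν u → NonFinal N ν v → Exchanges N ns i u v →
     Σ ℕ λ i₁ → Σ ℕ λ i₂ → Σ ℕ λ f₁ → Σ ℕ λ f₂ →
       IsFinal N ν f₁ × IsFinal N ν f₂ × f₁ ≢ f₂ ×
       Exchanges N ns i₁ u f₁ × Exchanges N ns i₂ v f₂)

MonotoneHeights : List ℕ → ℕ → Set
MonotoneHeights ns u =
  (∀ i → i < length ns → height ns i u ≤ height ns (suc i) u) ⊎
  (∀ i → i < length ns → height ns (suc i) u ≤ height ns i u)

module Submission where

-- The final vertices T (upper) and B (lower) are joined by an edge, and
-- every vertex strictly between them lies left or right of it.  Right exchanges
-- constrain these sides: a vertex crossing T downward lands left of the edge,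
-- one crossing B upward lands right, sides change only at such crossings, and
-- no exchange lifts a left vertex over a right one.  With the funnel conditions
-- this shows that, if D₀ is collapsible, a vertex starting above T never moves
-- up: it only ever crosses T, and a non-final vertex directly above it must
-- come from below B and so is right of the edge or below B.  The other three
-- cases (starting below B; D_k collapsible) follow by mirror symmetry and by
-- time reversal.

open import Defs
open import Data.Nat using (ℕ; zero; suc; pred; _+_; _∸_; _≤_; _<_; _≟_; _<?_; z≤n; s≤s)
open import Data.Nat.Properties
open import Data.Bool using (if_then_else_)
open import Data.Maybe using (just)
open import Data.List using (List; []; _∷_; take; length)
import Data.Product
open import Data.Product using (Σ; ∃; _×_; _,_; proj₁; proj₂; swap)
import Data.Sum as Sum
open import Data.Sum using (_⊎_; inj₁; inj₂; [_,_]′)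
open import Data.Empty using (⊥; ⊥-elim)
open import Relation.Nullary using (¬_; yes; no; Dec)
open import Relation.Nullary.Decidable using (⌊_⌋; _×-dec_)
open import Relation.Binary.PropositionalEquality
open import Function using (_∘_)
open import Algebra.Properties.CommutativeSemigroup +-commutativeSemigroup
  using () renaming (xy∙z≈xz∙y to +-swapʳ)

-- An abstract view of a reduction D₀ → … → D_k, seen from its two final
-- vertices T (upper) and B (lower): `Above i a b` says that a lies above b in
-- D_i, and `Ex i a b` that the i-th exchange swaps a (upper) with b (lower).
-- `Right i x` says that a vertex x strictly between T and B lies to the right
-- of the edge T — B.
record Frame : Set₁ where
  field
    k     : ℕ
    Above : ℕ → ℕ → ℕ → Set
    Ex    : ℕ → ℕ → ℕ → Set
    above-irrefl : ∀ {i a} → ¬ Above i a a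
    above-trans  : ∀ {i a b c} → Above i a b → Above i b c → Above i a c
    ex-dec    : ∀ i a b → Dec (Ex i a b)
    ex-bound  : ∀ {i a b} → Ex i a b → i < k
    ex-before : ∀ {i a b} → Ex i a b → Above i a b
    ex-after  : ∀ {i a b} → Ex i a b → Above (suc i) b a
    adjacent-before : ∀ {i a b c} → Ex i a b → Above i a c → Above i c b → ⊥
    adjacent-after  : ∀ {i a b c} → Ex i a b → Above (suc i) b c → Above (suc i) c a → ⊥
    stays-fwd : ∀ {i a b} → i < k → Above i a b → ¬ Ex i a b → Above (suc i) a b
    stays-bwd : ∀ {i a b} → i < k → Above (suc i) a b → ¬ Ex i b a → Above i a b
    T B       : ℕ
    T-above-B : ∀ {i} → i ≤ k → Above i T B

  Inside : ℕ → ℕ → Set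
  Inside i x = Above i T x × Above i x B

  Meets : ℕ → ℕ → ℕ → Set
  Meets i u f = Ex i u f ⊎ Ex i f u

  Crosses : ℕ → ℕ → Set
  Crosses i u = Meets i u T ⊎ Meets i u B

  Ordinary : ℕ → Set
  Ordinary u = u ≢ T × u ≢ B

  field
    Right : ℕ → ℕ → Set
    right-fwd : ∀ {i x} → i < k → Inside i x → Inside (suc i) x → Right i x → Right (suc i) x
    right-bwd : ∀ {i x} → i < k → Inside i x → Inside (suc i) x → Right (suc i) x → Right i x
    right-down : ∀ {i x y} → Ex i x y → Inside i x → Inside i y →
                 Inside (suc i) x → Inside (suc i) y → Right i x → Right i y
    cross-T-down : ∀ {i u} → Ex i u T → ¬ Right (suc i) u
    cross-T-up   : ∀ {i u} → Ex i T u → Right i u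
    cross-B-up   : ∀ {i u} → Ex i B u → Right (suc i) u
    cross-B-down : ∀ {i u} → Ex i u B → ¬ Right i u
    cross-once : ∀ {u i j} → Ordinary u → Crosses i u → Crosses j u → i ≡ j
    cross-pair : ∀ {i u w} → Ordinary u → Ordinary w → Ex i w u →
      (∃ (λ j → Meets j u T) × ∃ (λ j → Meets j w B)) ⊎
      (∃ (λ j → Meets j u B) × ∃ (λ j → Meets j w T))

  inside-fwd : ∀ {i x} → i < k → Inside i x → ¬ Crosses i x → Inside (suc i) x
  inside-fwd l (Tx , xB) quiet =
    stays-fwd l Tx (λ e → quiet (inj₁ (inj₂ e))) , stays-fwd l xB (λ e → quiet (inj₂ (inj₁ e)))

  Crossed : ℕ → ℕ → Set
  Crossed i u = Σ ℕ λ e → e < i × Crosses e u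

  settled : ∀ {u i} → Ordinary u → Crossed i u → ¬ Crosses i u
  settled ou (e , e<i , c) c′ = <-irrefl (cross-once ou c c′) e<i

  Collapsible : ℕ → Set
  Collapsible c = ∀ w → Ordinary w → Above c w T ⊎ Above c B w

  NeverRises NeverSinks : ℕ → Set
  NeverRises u = ∀ i w → ¬ Ex i w u
  NeverSinks u = ∀ i w → ¬ Ex i u w

mirror-crossing : ∀ {P Q R S : Set} → (P ⊎ Q) ⊎ (R ⊎ S) → (S ⊎ R) ⊎ (Q ⊎ P)
mirror-crossing = Sum.swap ∘ Sum.map Sum.swap Sum.swap

mirror : Frame → Frame
mirror F = record
  { k = k
  ; Above = λ i a b → Above i b a
  ; Ex = λ i a b → Ex i b a
  ; above-irrefl = above-irrefl
  ; above-trans = λ ba cb → above-trans cb ba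
  ; ex-dec = λ i a b → ex-dec i b a
  ; ex-bound = ex-bound
  ; ex-before = ex-before
  ; ex-after = ex-after
  ; adjacent-before = λ e ca bc → adjacent-before e bc ca
  ; adjacent-after = λ e cb ac → adjacent-after e ac cb
  ; stays-fwd = stays-fwd
  ; stays-bwd = stays-bwd
  ; T = B
  ; B = T
  ; T-above-B = T-above-B
  ; Right = λ i x → ¬ Right i x
  ; right-fwd = λ l x x′ nr r → nr (right-bwd l (swap x) (swap x′) r)
  ; right-bwd = λ l x x′ nr r → nr (right-fwd l (swap x) (swap x′) r)
  ; right-down = λ e x y x′ y′ nrx ry →
      nrx (right-down e (swap y) (swap x) (swap y′) (swap x′) ry)
  ; cross-T-down = λ e nr → nr (cross-B-up e)
  ; cross-T-up = cross-B-down
  ; cross-B-up = cross-T-down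
  ; cross-B-down = λ e nr → nr (cross-T-up e)
  ; cross-once = λ ou c c′ → cross-once (swap ou) (mirror-crossing c) (mirror-crossing c′)
  ; cross-pair = λ ou ow e → Sum.map turn turn (cross-pair (swap ow) (swap ou) e)
  }
  where
  open Frame F
  turn : ∀ {P Q R S : ℕ → Set} → ∃ (λ j → P j ⊎ Q j) × ∃ (λ j → R j ⊎ S j) →
         ∃ (λ j → S j ⊎ R j) × ∃ (λ j → Q j ⊎ P j)
  turn ((j , m) , (j′ , m′)) = (j′ , Sum.swap m′) , (j , Sum.swap m)

-- Time reflection i ↦ k ∸ i of {0, …, k}; step i of the reflected sequence is
-- step k ∸ suc i of the original one.
reflect-suc : ∀ {k i} → i < k → k ∸ i ≡ suc (k ∸ suc i)
reflect-suc l = +-∸-assoc 1 l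

reflect-< : ∀ {k i} → i < k → k ∸ suc i < k
reflect-< {suc k} {i} _ = s≤s (m∸n≤m k i)

reflect-involutive : ∀ {k j} → j < k → k ∸ suc (k ∸ suc j) ≡ j
reflect-involutive {k} {j} l = begin
  k ∸ suc (k ∸ suc j)    ≡⟨ sym (pred[m∸n]≡m∸[1+n] k (k ∸ suc j)) ⟩
  pred (k ∸ (k ∸ suc j)) ≡⟨ cong pred (m∸[m∸n]≡n l) ⟩
  j                      ∎
  where open ≡-Reasoning

reflect-injective : ∀ {k i i′} → i < k → i′ < k → k ∸ suc i ≡ k ∸ suc i′ → i ≡ i′
reflect-injective l l′ eq = suc-injective (∸-cancelˡ-≡ l l′ eq)

reflected : ∀ {F : Frame} {j a b} → let open Frame F in
  Ex j a b → k ∸ suc j < k × Ex (k ∸ suc (k ∸ suc j)) a b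
reflected {F} e = reflect-< l , subst (λ t → Ex t _ _) (sym (reflect-involutive l)) e
  where
  open Frame F
  l = ex-bound e

-- The time-reversed frame: read backwards, a right exchange of a over b is a
-- right exchange of b over a; reversing time also swaps the two sides.
reverse : Frame → Frame
reverse F = record
  { k = k
  ; Above = λ i → Above (k ∸ i)
  ; Ex = λ i a b → i < k × Ex (k ∸ suc i) b a
  ; above-irrefl = above-irrefl
  ; above-trans = above-trans
  ; ex-dec = λ i a b → (i <? k) ×-dec ex-dec (k ∸ suc i) b a
  ; ex-bound = proj₁
  ; ex-before = λ (l , e) → earlier l (ex-after e)
  ; ex-after = λ (_ , e) → ex-before e
  ; adjacent-before = λ (l , e) ac cb → adjacent-after e (later l ac) (later l cb)
  ; adjacent-after = λ (_ , e) bc ca → adjacent-before e bc ca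
  ; stays-fwd = λ l ab ne → stays-bwd (reflect-< l) (later l ab) (λ e → ne (l , e))
  ; stays-bwd = λ l ab ne → earlier l (stays-fwd (reflect-< l) ab (λ e → ne (l , e)))
  ; T = T
  ; B = B
  ; T-above-B = λ {i} _ → T-above-B (m∸n≤m k i)
  ; Right = λ i x → ¬ Right (k ∸ i) x
  ; right-fwd = rev-right-fwd
  ; right-bwd = rev-right-bwd
  ; right-down = rev-right-down
  ; cross-T-down = λ (_ , e) nr → nr (cross-T-up e)
  ; cross-T-up = λ (l , e) → rev-cross-T-up l e
  ; cross-B-up = λ (_ , e) → cross-B-down e
  ; cross-B-down = λ (l , e) → rev-cross-B-down l e
  ; cross-once = λ ou c c′ →
      reflect-injective (proj₁ (unrev c)) (proj₁ (unrev c′))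
        (cross-once ou (proj₂ (unrev c)) (proj₂ (unrev c′)))
  ; cross-pair = λ ou ow (_ , e) → Sum.swap (Sum.map turn turn (cross-pair ow ou e))
  }
  where
  open Frame F

  earlier : ∀ {i a b} → i < k → Above (suc (k ∸ suc i)) a b → Above (k ∸ i) a b
  earlier l rewrite reflect-suc l = λ ab → ab

  later : ∀ {i a b} → i < k → Above (k ∸ i) a b → Above (suc (k ∸ suc i)) a b
  later l rewrite reflect-suc l = λ ab → ab

  rev-right-fwd : ∀ {i x} → i < k → Inside (k ∸ i) x → Inside (k ∸ suc i) x →
                  ¬ Right (k ∸ i) x → ¬ Right (k ∸ suc i) x
  rev-right-fwd l rewrite reflect-suc l = λ x x′ nr r → nr (right-fwd (reflect-< l) x′ x r)

  rev-right-bwd : ∀ {i x} → i < k → Inside (k ∸ i) x → Inside (k ∸ suc i) x →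
                  ¬ Right (k ∸ suc i) x → ¬ Right (k ∸ i) x
  rev-right-bwd l rewrite reflect-suc l = λ x x′ nr r → nr (right-bwd (reflect-< l) x′ x r)

  rev-right-down : ∀ {i x y} → i < k × Ex (k ∸ suc i) y x →
    Inside (k ∸ i) x → Inside (k ∸ i) y → Inside (k ∸ suc i) x → Inside (k ∸ suc i) y →
    ¬ Right (k ∸ i) x → ¬ Right (k ∸ i) y
  rev-right-down (l , e) rewrite reflect-suc l = λ x y x′ y′ nrx ry →
    nrx (right-fwd j<k x′ x (right-down e y′ x′ y x (right-bwd j<k y′ y ry)))
    where j<k = reflect-< l

  rev-cross-T-up : ∀ {i u} → i < k → Ex (k ∸ suc i) u T → ¬ Right (k ∸ i) u
  rev-cross-T-up l rewrite reflect-suc l = cross-T-down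

  rev-cross-B-down : ∀ {i u} → i < k → Ex (k ∸ suc i) B u → ¬ ¬ Right (k ∸ i) u
  rev-cross-B-down l rewrite reflect-suc l = λ e nr → nr (cross-B-up e)

  RMeets : ℕ → ℕ → ℕ → Set
  RMeets i u f = (i < k × Ex (k ∸ suc i) f u) ⊎ (i < k × Ex (k ∸ suc i) u f)

  unrev-meets : ∀ {i u f} → RMeets i u f → i < k × Meets (k ∸ suc i) u f
  unrev-meets (inj₁ (l , e)) = l , inj₂ e
  unrev-meets (inj₂ (l , e)) = l , inj₁ e

  unrev : ∀ {i u} → RMeets i u T ⊎ RMeets i u B → i < k × Crosses (k ∸ suc i) u
  unrev (inj₁ m) = Data.Product.map₂ inj₁ (unrev-meets m)
  unrev (inj₂ m) = Data.Product.map₂ inj₂ (unrev-meets m)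

  rev-meets : ∀ {j u f} → Meets j u f → ∃ λ i → RMeets i u f
  rev-meets (inj₁ e) = _ , inj₂ (reflected {F} e)
  rev-meets (inj₂ e) = _ , inj₁ (reflected {F} e)

  turn : ∀ {u f w g} → ∃ (λ j → Meets j u f) × ∃ (λ j → Meets j w g) →
         ∃ (λ i → RMeets i w g) × ∃ (λ i → RMeets i u f)
  turn ((_ , m) , (_ , m′)) = rev-meets m′ , rev-meets m

-- History of an ordinary vertex u that starts above T: it stays above T
-- until it crosses T, and from then on it is inside, left of the edge.
module Origin (F : Frame) where
  open Frame F

  History : ℕ → ℕ → Set
  History u i = Above i u T ⊎ (Inside i u × ¬ Right i u × Crossed i u)

  history-step : ∀ {u i} → Ordinary u → i < k → History u i → History u (suc i)
  history-step {u} {i} ou l (inj₁ uT) with ex-dec i u T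
  ... | no quiet = inj₁ (stays-fwd l uT quiet)
  ... | yes e = inj₂ ((ex-after e , stays-fwd l uB (λ e′ → adjacent-before e′ uT TB)) ,
                      cross-T-down e , i , ≤-refl , inj₁ (inj₁ e))
    where
    TB = T-above-B (<⇒≤ l)
    uB = above-trans uT TB
  history-step ou l (inj₂ (ins , left , e , e<i , c)) =
    inj₂ (ins′ , (λ r → left (right-bwd l ins ins′ r)) , e , m≤n⇒m≤1+n e<i , c)
    where ins′ = inside-fwd l ins (settled ou (e , e<i , c))

  history : ∀ {u} → Ordinary u → Above 0 u T → ∀ i → i ≤ k → History u i
  history ou uT zero _ = inj₁ uT
  history ou uT (suc i) l = history-step ou l (history ou uT i (<⇒≤ l))

  never-meets-B : ∀ {u} → Ordinary u → Above 0 u T → ∀ j → ¬ Meets j u B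
  never-meets-B ou uT j m with history ou uT j (<⇒≤ ([ ex-bound , ex-bound ]′ m))
  never-meets-B ou uT j (inj₁ e) | inj₁ uTj = adjacent-before e uTj (T-above-B (<⇒≤ (ex-bound e)))
  never-meets-B ou uT j (inj₂ e) | inj₁ uTj =
    above-irrefl (above-trans (ex-before e) (above-trans uTj (T-above-B (<⇒≤ (ex-bound e)))))
  never-meets-B ou uT j m | inj₂ (_ , _ , past) = settled ou past (inj₂ m)

  never-rises-over-T : ∀ {u} → Ordinary u → Above 0 u T → ∀ j → ¬ Ex j T u
  never-rises-over-T ou uT j e with history ou uT j (<⇒≤ (ex-bound e))
  ... | inj₁ uTj = above-irrefl (above-trans uTj (ex-before e))
  ... | inj₂ (_ , _ , past) = settled ou past (inj₁ (inj₂ e))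

module Descent (F : Frame) where
  open Frame F
  module Top = Origin F
  module Bottom = Origin (mirror F)

  clash : ∀ {u w i} → Ordinary u → Ordinary w → Ex i w u →
          Top.History u i → Bottom.History w i → ⊥
  clash ou ow e (inj₁ uT) (inj₁ Bw) =
    above-irrefl (above-trans (ex-before e) (above-trans uT (above-trans (T-above-B (<⇒≤ (ex-bound e))) Bw)))
  clash ou ow e (inj₁ uT) (inj₂ ((_ , Tw) , _)) =
    above-irrefl (above-trans Tw (above-trans (ex-before e) uT))
  clash ou ow e (inj₂ ((_ , uB) , _)) (inj₁ Bw) =
    above-irrefl (above-trans (ex-before e) (above-trans uB Bw))
  clash {u} {w} {i} ou ow e (inj₂ (insu , left , pastu)) (inj₂ ((wB , Tw) , notleft , pastw)) =
    notleft (λ rw → left (right-down e insw insu (inside-fwd l insw quietw) (inside-fwd l insu quietu) rw))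
    where
    l = ex-bound e
    insw = Tw , wB
    quietu = settled ou pastu
    quietw : ¬ Crosses i w
    quietw c = Frame.settled (mirror F) (swap ow) pastw (mirror-crossing c)

  never-rises : Collapsible 0 → ∀ {u} → Ordinary u → Above 0 u T → NeverRises u
  never-rises coll {u} ou uT i w e with w ≟ T | w ≟ B
  ... | yes refl | _ = Top.never-rises-over-T ou uT i e
  ... | no _ | yes refl = Top.never-meets-B ou uT i (inj₂ e)
  ... | no w≢T | no w≢B with cross-pair ou (w≢T , w≢B) e
  ...   | inj₂ ((j , uB) , _) = Top.never-meets-B ou uT j uB
  ...   | inj₁ (_ , (j , wB)) with coll w (w≢T , w≢B)
  ...     | inj₁ wT = Top.never-meets-B (w≢T , w≢B) wT j wB
  ...     | inj₂ Bw = clash ou (w≢T , w≢B) e (Top.history ou uT i (<⇒≤ (ex-bound e)))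
                        (Bottom.history (w≢B , w≢T) Bw i (<⇒≤ (ex-bound e)))

steady-from-start : (F : Frame) → Frame.Collapsible F 0 →
  ∀ {u} → Frame.Ordinary F u → Frame.NeverRises F u ⊎ Frame.NeverSinks F u
steady-from-start F coll ou with coll _ ou
... | inj₁ uT = inj₁ (Descent.never-rises F coll ou uT)
... | inj₂ Bu = inj₂ (Descent.never-rises (mirror F) (λ w ow → Sum.swap (coll w (swap ow))) (swap ou) Bu)

steady : (F : Frame) → Frame.Collapsible F 0 ⊎ Frame.Collapsible F (Frame.k F) →
  ∀ {u} → Frame.Ordinary F u → Frame.NeverRises F u ⊎ Frame.NeverSinks F u
steady F (inj₁ coll) ou = steady-from-start F coll ou
steady F (inj₂ coll) {u} ou with steady-from-start (reverse F) coll ou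
... | inj₁ never = inj₂ λ j w e → never _ w (reflected {F} e)
... | inj₂ never = inj₁ λ j w e → never _ w (reflected {F} e)

data SwapView (n x : ℕ) : Set where
  upper : x ≡ n → SwapView n x
  lower : x ≡ suc n → SwapView n x
  other : x ≢ n → x ≢ suc n → SwapView n x

swapView : ∀ n x → SwapView n x
swapView n x with x ≟ n | x ≟ suc n
... | yes e | _     = upper e
... | no p  | yes e = lower e
... | no p  | no q  = other p q

n≢1+n : ∀ {n} → n ≢ suc n
n≢1+n ()

<⇒≢1+ : ∀ {m n} → m < n → m ≢ suc n
<⇒≢1+ {n = n} m<n refl = <-asym m<n (n<1+n n)

swap-upper : ∀ n → swapAt n n ≡ suc n
swap-upper n with n ≟ n
... | yes _ = refl
... | no ne = ⊥-elim (ne refl)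

swap-lower : ∀ n → swapAt n (suc n) ≡ n
swap-lower n with suc n ≟ n | suc n ≟ suc n
... | yes e | _     = ⊥-elim (n≢1+n (sym e))
... | no _  | yes _ = refl
... | no _  | no ne = ⊥-elim (ne refl)

swap-other : ∀ n x → x ≢ n → x ≢ suc n → swapAt n x ≡ x
swap-other n x p q with x ≟ n | x ≟ suc n
... | yes e | _     = ⊥-elim (p e)
... | no _  | yes e = ⊥-elim (q e)
... | no _  | no _  = refl

upd-upper : ∀ n a b f → upd n a b f n ≡ a
upd-upper n a b f with n ≟ n
... | yes _ = refl
... | no ne = ⊥-elim (ne refl)

upd-lower : ∀ n a b f → upd n a b f (suc n) ≡ b
upd-lower n a b f with suc n ≟ n | suc n ≟ suc n
... | yes e | _     = ⊥-elim (n≢1+n (sym e))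
... | no _  | yes _ = refl
... | no _  | no ne = ⊥-elim (ne refl)

upd-other : ∀ n a b f m → m ≢ n → m ≢ suc n → upd n a b f m ≡ f m
upd-other n a b f m p q with m ≟ n | m ≟ suc n
... | yes e | _     = ⊥-elim (p e)
... | no _  | yes e = ⊥-elim (q e)
... | no _  | no _  = refl

swap-involutive : ∀ n x → swapAt n (swapAt n x) ≡ x
swap-involutive n x with swapView n x
... | upper refl = trans (cong (swapAt n) (swap-upper n)) (swap-lower n)
... | lower refl = trans (cong (swapAt n) (swap-lower n)) (swap-upper n)
... | other p q  = trans (cong (swapAt n) (swap-other n x p q)) (swap-other n x p q)

swap-injective : ∀ n x y → swapAt n x ≡ swapAt n y → x ≡ y
swap-injective n x y e =
  trans (sym (swap-involutive n x)) (trans (cong (swapAt n) e) (swap-involutive n y))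

swap-monotone : ∀ n x y → x < y → ¬ (x ≡ n × y ≡ suc n) → swapAt n x < swapAt n y
swap-monotone n x y x<y notPair with swapView n x | swapView n y
... | upper refl | upper refl = ⊥-elim (<-irrefl refl x<y)
... | upper refl | lower refl = ⊥-elim (notPair (refl , refl))
... | upper refl | other p q rewrite swap-upper n | swap-other n y p q = ≤∧≢⇒< x<y (q ∘ sym)
... | lower refl | upper refl = ⊥-elim (<-asym x<y (n<1+n n))
... | lower refl | lower refl = ⊥-elim (<-irrefl refl x<y)
... | lower refl | other p q rewrite swap-lower n | swap-other n y p q = <-trans (n<1+n n) x<y
... | other p q | upper refl rewrite swap-upper n | swap-other n x p q = <-trans x<y (n<1+n n)
... | other p q | lower refl rewrite swap-lower n | swap-other n x p q = ≤∧≢⇒< (≤-pred x<y) p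
... | other p q | other p′ q′ rewrite swap-other n x p q | swap-other n y p′ q′ = x<y

-- A wire k at the level above a vertex (offset h, i inputs, o outputs) that is
-- not an input of it continues as wire k′ below it, to its left (unchanged)
-- or to its right (shifted by o − i).
Passes : ℕ → ℕ → ℕ → ℕ → ℕ → Set
Passes h i o k k′ = (k < h × k′ ≡ k) ⊎ (h + i ≤ k × k′ + i ≡ k + o)

pass↓ pass↑ : ℕ → ℕ → ℕ → ℕ → ℕ
pass↓ h i o k = if ⌊ k <? h ⌋ then k else (k + o) ∸ i
pass↑ h i o k = if ⌊ k <? h ⌋ then k else (k + i) ∸ o

pass↓-left : ∀ h i o {k} → k < h → pass↓ h i o k ≡ k
pass↓-left h i o {k} k<h with k <? h
... | yes _ = refl
... | no k≮h = ⊥-elim (k≮h k<h)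

h+i≤k⇒k≮h : ∀ {h i k} → h + i ≤ k → ¬ k < h
h+i≤k⇒k≮h {h} {i} le k<h = <⇒≱ k<h (≤-trans (m≤m+n h i) le)

shifted : ∀ h i o {k} → h + i ≤ k → (k + o) ∸ i + i ≡ k + o
shifted h i o {k} le = m∸n+n≡m (≤-trans (≤-trans (m≤n+m i h) le) (m≤m+n k o))

pass↓-right : ∀ h i o {k} → h + i ≤ k → pass↓ h i o k + i ≡ k + o
pass↓-right h i o {k} le with k <? h
... | yes k<h = ⊥-elim (h+i≤k⇒k≮h le k<h)
... | no _ = shifted h i o le

pass↑-right : ∀ h i o {k} → h + o ≤ k → pass↑ h i o k + o ≡ k + i
pass↑-right h i o {k} le with k <? h
... | yes k<h = ⊥-elim (h+i≤k⇒k≮h le k<h)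
... | no _ = shifted h o i le

passes-left : ∀ {h i o k k′} → k < h → Passes h i o k k′ → k′ ≡ k
passes-left _ (inj₁ (_ , eq)) = eq
passes-left k<h (inj₂ (le , _)) = ⊥-elim (h+i≤k⇒k≮h le k<h)

-- The local arithmetic of an admissible right exchange: the upper vertex x
-- (offset hx, ix inputs, ox outputs) and the lower vertex y (hy, iy, oy), with
-- hx + ox ≤ hy, trade places; afterwards y has offset hy′ = hy + ix − ox.
module ExchangeArithmetic (hx ix ox hy iy oy : ℕ) (adm : hx + ox ≤ hy) where

  hy′ : ℕ
  hy′ = (hy + ix) ∸ ox

  shift : hy′ + ox ≡ hy + ix
  shift = shifted hx ox ix adm

  hx+ix≤hy′ : hx + ix ≤ hy′
  hx+ix≤hy′ = +-cancelʳ-≤ ox _ _ (begin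
    hx + ix + ox ≡⟨ +-swapʳ hx ix ox ⟩
    hx + ox + ix ≤⟨ +-monoˡ-≤ ix adm ⟩
    hy + ix      ≡⟨ shift ⟨
    hy′ + ox     ∎)
    where open ≤-Reasoning

  hx≤hy′ : hx ≤ hy′
  hx≤hy′ = ≤-trans (m≤m+n hx ix) hx+ix≤hy′

  hx≤hy : hx ≤ hy
  hx≤hy = ≤-trans (m≤m+n hx ox) adm

  -- a wire passing x then y before the exchange passes y then x after it
  -- (through wire k₁′ of the middle level), keeping its side of each vertex
  record Commuted (k₀ k₁ k₂ : ℕ) : Set where
    field
      passes-y : Passes hy′ iy oy k₀ (pass↓ hy′ iy oy k₀)
      passes-x : Passes hx ix ox (pass↓ hy′ iy oy k₀) k₂
      left-of-x : k₀ < hx → pass↓ hy′ iy oy k₀ < hx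
      left-of-x⁻¹ : pass↓ hy′ iy oy k₀ < hx → k₀ < hx
      left-of-y : k₁ < hy → k₀ < hy′
      left-of-y⁻¹ : k₀ < hy′ → k₁ < hy

  commute-left : ∀ {k₀ k₂} → k₀ < hx → Passes hy iy oy k₀ k₂ → Commuted k₀ k₀ k₂
  commute-left {k₀} {k₂} k₀<hx y-pass = record
    { passes-y = inj₁ (k₀<hy′ , same)
    ; passes-x = inj₁ (subst (_< hx) (sym same) k₀<hx , trans (passes-left k₀<hy y-pass) (sym same))
    ; left-of-x = λ _ → subst (_< hx) (sym same) k₀<hx
    ; left-of-x⁻¹ = λ _ → k₀<hx
    ; left-of-y = λ _ → k₀<hy′
    ; left-of-y⁻¹ = λ _ → k₀<hy }
    where
    k₀<hy′ = <-≤-trans k₀<hx hx≤hy′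
    k₀<hy = <-≤-trans k₀<hx hx≤hy
    same = pass↓-left hy′ iy oy k₀<hy′
  commute-between : ∀ {k₀ k₁} → hx + ix ≤ k₀ → k₁ + ix ≡ k₀ + ox → k₁ < hy → Commuted k₀ k₁ k₁
  commute-between {k₀} {k₁} x≤k₀ eq₀ k₁<hy = record
    { passes-y = inj₁ (k₀<hy′ , same)
    ; passes-x = inj₂ (subst (hx + ix ≤_) (sym same) x≤k₀ , trans eq₀ (cong (_+ ox) (sym same)))
    ; left-of-x = λ k₀<hx → ⊥-elim (h+i≤k⇒k≮h x≤k₀ k₀<hx)
    ; left-of-x⁻¹ = λ l → ⊥-elim (h+i≤k⇒k≮h x≤k₀ (subst (_< hx) same l))
    ; left-of-y = λ _ → k₀<hy′
    ; left-of-y⁻¹ = λ _ → k₁<hy }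
    where
    k₀<hy′ : k₀ < hy′
    k₀<hy′ = +-cancelʳ-< ox _ _ (begin-strict
      k₀ + ox ≡⟨ eq₀ ⟨
      k₁ + ix <⟨ +-monoˡ-< ix k₁<hy ⟩
      hy + ix ≡⟨ shift ⟨
      hy′ + ox ∎)
      where open ≤-Reasoning
    same = pass↓-left hy′ iy oy k₀<hy′
  commute-right : ∀ {k₀ k₁ k₂} → hx + ix ≤ k₀ → k₁ + ix ≡ k₀ + ox →
                  hy + iy ≤ k₁ → k₂ + iy ≡ k₁ + oy → Commuted k₀ k₁ k₂
  commute-right {k₀} {k₁} {k₂} x≤k₀ eq₀ y≤k₁ eq₁ = record
    { passes-y = inj₂ (y′≤k₀ , eq₀′)
    ; passes-x = inj₂ (x≤k₁′ , eq₁′)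
    ; left-of-x = λ l → ⊥-elim (h+i≤k⇒k≮h x≤k₀ l)
    ; left-of-x⁻¹ = λ l → ⊥-elim (h+i≤k⇒k≮h x≤k₁′ l)
    ; left-of-y = λ l → ⊥-elim (h+i≤k⇒k≮h y≤k₁ l)
    ; left-of-y⁻¹ = λ l → ⊥-elim (h+i≤k⇒k≮h y′≤k₀ l) }
    where
    open ≤-Reasoning
    k₁′ = pass↓ hy′ iy oy k₀
    y′≤k₀ : hy′ + iy ≤ k₀
    y′≤k₀ = +-cancelʳ-≤ ox _ _ (begin
      hy′ + iy + ox ≡⟨ +-swapʳ hy′ iy ox ⟩
      hy′ + ox + iy ≡⟨ cong (_+ iy) shift ⟩
      hy + ix + iy  ≡⟨ +-swapʳ hy ix iy ⟩
      hy + iy + ix  ≤⟨ +-monoˡ-≤ ix y≤k₁ ⟩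
      k₁ + ix       ≡⟨ eq₀ ⟩
      k₀ + ox       ∎)
    eq₀′ : k₁′ + iy ≡ k₀ + oy
    eq₀′ = pass↓-right hy′ iy oy y′≤k₀
    eq₁′ : k₂ + ix ≡ k₁′ + ox
    eq₁′ = +-cancelʳ-≡ iy _ _ (begin-equality
      k₂ + ix + iy  ≡⟨ +-swapʳ k₂ ix iy ⟩
      k₂ + iy + ix  ≡⟨ cong (_+ ix) eq₁ ⟩
      k₁ + oy + ix  ≡⟨ +-swapʳ k₁ oy ix ⟩
      k₁ + ix + oy  ≡⟨ cong (_+ oy) eq₀ ⟩
      k₀ + ox + oy  ≡⟨ +-swapʳ k₀ ox oy ⟩
      k₀ + oy + ox  ≡⟨ cong (_+ ox) eq₀′ ⟨
      k₁′ + iy + ox ≡⟨ +-swapʳ k₁′ iy ox ⟩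
      k₁′ + ox + iy ∎)
    hy≤k₂ : hy ≤ k₂
    hy≤k₂ = +-cancelʳ-≤ iy _ _ (begin
      hy + iy      ≤⟨ m≤m+n (hy + iy) oy ⟩
      hy + iy + oy ≤⟨ +-monoˡ-≤ oy y≤k₁ ⟩
      k₁ + oy      ≡⟨ eq₁ ⟨
      k₂ + iy      ∎)
    x≤k₁′ : hx + ix ≤ k₁′
    x≤k₁′ = +-cancelʳ-≤ ox _ _ (begin
      hx + ix + ox ≡⟨ +-swapʳ hx ix ox ⟩
      hx + ox + ix ≤⟨ +-monoˡ-≤ ix (≤-trans adm hy≤k₂) ⟩
      k₂ + ix      ≡⟨ eq₁′ ⟩
      k₁′ + ox     ∎)

  commute : ∀ {k₀ k₁ k₂} → Passes hx ix ox k₀ k₁ → Passes hy iy oy k₁ k₂ → Commuted k₀ k₁ k₂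
  commute (inj₁ (k₀<hx , refl)) y-pass = commute-left k₀<hx y-pass
  commute (inj₂ (x≤k₀ , eq₀)) (inj₁ (k₁<hy , refl)) = commute-between x≤k₀ eq₀ k₁<hy
  commute (inj₂ (x≤k₀ , eq₀)) (inj₂ (y≤k₁ , eq₁)) = commute-right x≤k₀ eq₀ y≤k₁ eq₁

  enters-x : ∀ {k₀} → k₀ < hx + ix → k₀ < hy′
  enters-x lt = <-≤-trans lt hx+ix≤hy′

  enters-y : ∀ {k₀ k₁} → Passes hx ix ox k₀ k₁ → hy ≤ k₁ → k₁ < hy + iy →
             hx + ix ≤ k₀ × hy′ ≤ k₀ × k₀ < hy′ + iy
  enters-y (inj₁ (k₀<hx , refl)) hy≤k₀ _ = ⊥-elim (<⇒≱ k₀<hx (≤-trans hx≤hy hy≤k₀))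
  enters-y {k₀} {k₁} (inj₂ (x≤k₀ , eq)) hy≤k₁ k₁<y = x≤k₀ ,
    +-cancelʳ-≤ ox _ _ (begin
      hy′ + ox ≡⟨ shift ⟩
      hy + ix  ≤⟨ +-monoˡ-≤ ix hy≤k₁ ⟩
      k₁ + ix  ≡⟨ eq ⟩
      k₀ + ox  ∎) ,
    +-cancelʳ-< ox _ _ (begin-strict
      k₀ + ox       ≡⟨ eq ⟨
      k₁ + ix       <⟨ +-monoˡ-< ix k₁<y ⟩
      hy + iy + ix  ≡⟨ +-swapʳ hy iy ix ⟩
      hy + ix + iy  ≡⟨ cong (_+ iy) shift ⟨
      hy′ + ox + iy ≡⟨ +-swapʳ hy′ ox iy ⟩
      hy′ + iy + ox ∎)
    where open ≤-Reasoning

  leaves-x : ∀ {k₁ k₂} → k₁ < hx + ox → Passes hy iy oy k₁ k₂ → k₁ < hy × k₂ ≡ k₁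
  leaves-x _ (inj₁ left) = left
  leaves-x lt (inj₂ (y≤k₁ , _)) = ⊥-elim (<⇒≱ lt (≤-trans adm (≤-trans (m≤m+n hy iy) y≤k₁)))

  leaves-y : ∀ {k₂} → hy ≤ k₂ → k₂ < hy + oy →
    let k₁′ = pass↑ hx ix ox k₂ in
    hy′ ≤ k₁′ × k₁′ < hy′ + oy × Passes hx ix ox k₁′ k₂ × hx + ix ≤ k₁′
  leaves-y {k₂} hy≤k₂ k₂<y = y′≤k₁′ , k₁′<y′ , inj₂ (x≤k₁′ , sym eq) , x≤k₁′
    where
    open ≤-Reasoning
    k₁′ = pass↑ hx ix ox k₂
    eq : k₁′ + ox ≡ k₂ + ix
    eq = pass↑-right hx ix ox (≤-trans adm hy≤k₂)
    y′≤k₁′ : hy′ ≤ k₁′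
    y′≤k₁′ = +-cancelʳ-≤ ox _ _ (begin
      hy′ + ox ≡⟨ shift ⟩
      hy + ix  ≤⟨ +-monoˡ-≤ ix hy≤k₂ ⟩
      k₂ + ix  ≡⟨ eq ⟨
      k₁′ + ox ∎)
    k₁′<y′ : k₁′ < hy′ + oy
    k₁′<y′ = +-cancelʳ-< ox _ _ (begin-strict
      k₁′ + ox      ≡⟨ eq ⟩
      k₂ + ix       <⟨ +-monoˡ-< ix k₂<y ⟩
      hy + oy + ix  ≡⟨ +-swapʳ hy oy ix ⟩
      hy + ix + oy  ≡⟨ cong (_+ oy) shift ⟨
      hy′ + ox + oy ≡⟨ +-swapʳ hy′ ox oy ⟩
      hy′ + oy + ox ∎)
    x≤k₁′ : hx + ix ≤ k₁′
    x≤k₁′ = +-cancelʳ-≤ ox _ _ (begin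
      hx + ix + ox ≡⟨ +-swapʳ hx ix ox ⟩
      hx + ox + ix ≤⟨ +-monoˡ-≤ ix (≤-trans adm hy≤k₂) ⟩
      k₂ + ix      ≡⟨ eq ⟨
      k₁′ + ox     ∎)

  left-of-both : ∀ {k₀ k₁} → Passes hx ix ox k₀ k₁ → k₀ < hx → k₁ < hy
  left-of-both (inj₁ (k₀<hx , refl)) _ = <-≤-trans k₀<hx hx≤hy
  left-of-both (inj₂ (x≤k₀ , _)) k₀<hx = ⊥-elim (h+i≤k⇒k≮h x≤k₀ k₀<hx)

PassesAt : Diagram → ℕ → ℕ → ℕ → Set
PassesAt D m = Passes (H D m) (I D m) (O D m)

-- The edge from the vertex at height a to the vertex at height b > a, traced
-- level by level: κ m is its wire at level m, for a < m ≤ b.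
record EdgeTrace (D : Diagram) (a b : ℕ) (κ : ℕ → ℕ) : Set where
  field
    a<b : a < b
    leaves-lo : H D a ≤ κ (suc a)
    leaves-hi : κ (suc a) < H D a + O D a
    passes : ∀ m → a < m → m < b → PassesAt D m (κ m) (κ (suc m))
    enters-lo : H D b ≤ κ b
    enters-hi : κ b < H D b + I D b

-- the vertex at height h, strictly between a and b, lies right of the edge
RightOf : Diagram → (ℕ → ℕ) → ℕ → Set
RightOf D κ h = κ h < H D h

-- The trace after an exchange at height n: only level n+1 changes.  If the
-- edge starts at the lower vertex, its new wire there is read off from level
-- n+2; otherwise it is carried down from level n.
retrace : Diagram → ℕ → ℕ → (ℕ → ℕ) → ℕ → ℕ
retrace D a n κ m = if ⌊ m ≟ suc n ⌋
  then (if ⌊ a ≟ suc n ⌋ then pass↑ (H D n) (I D n) (O D n) (κ (suc (suc n)))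
        else pass↓ ((H D (suc n) + I D n) ∸ O D n) (I D (suc n)) (O D (suc n)) (κ n))
  else κ m

retrace-other : ∀ D a n κ m → m ≢ suc n → retrace D a n κ m ≡ κ m
retrace-other D a n κ m ne with m ≟ suc n
... | yes e = ⊥-elim (ne e)
... | no _ = refl

retrace-up : ∀ D a n κ → a ≡ suc n →
  retrace D a n κ (suc n) ≡ pass↑ (H D n) (I D n) (O D n) (κ (suc (suc n)))
retrace-up D a n κ a≡ with suc n ≟ suc n | a ≟ suc n
... | no ne | _ = ⊥-elim (ne refl)
... | yes _ | yes _ = refl
... | yes _ | no ne = ⊥-elim (ne a≡)

retrace-down : ∀ D a n κ → a ≢ suc n →
  retrace D a n κ (suc n) ≡ pass↓ ((H D (suc n) + I D n) ∸ O D n) (I D (suc n)) (O D (suc n)) (κ n)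
retrace-down D a n κ a≢ with suc n ≟ suc n | a ≟ suc n
... | no ne | _ = ⊥-elim (ne refl)
... | yes _ | yes e = ⊥-elim (a≢ e)
... | yes _ | no _ = refl

passes-cong : ∀ {h i o h′ i′ o′ k k′} → h ≡ h′ → i ≡ i′ → o ≡ o′ →
              Passes h i o k k′ → Passes h′ i′ o′ k k′
passes-cong refl refl refl p = p

swap-below : ∀ n m x → m ≢ n → m ≢ suc n → swapAt n x < m → x < m
swap-below n m x p q lt with swapView n x
... | upper refl rewrite swap-upper n = <-trans (n<1+n n) lt
... | lower refl rewrite swap-lower n = ≤∧≢⇒< lt (q ∘ sym)
... | other p′ q′ rewrite swap-other n x p′ q′ = lt

swap-above : ∀ n m x → m ≢ n → m ≢ suc n → m < swapAt n x → m < x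
swap-above n m x p q lt with swapView n x
... | upper refl rewrite swap-upper n = ≤∧≢⇒< (≤-pred lt) p
... | lower refl rewrite swap-lower n = <-trans lt (n<1+n n)
... | other p′ q′ rewrite swap-other n x p′ q′ = lt

module AtExchange (D : Diagram) (n : ℕ) (adm : Admissible D n) where
  open ExchangeArithmetic (H D n) (I D n) (O D n) (H D (suc n)) (I D (suc n)) (O D (suc n))
    (proj₂ adm) public

  D′ = rex D n

  y′-at-n : H D′ n ≡ hy′ × I D′ n ≡ I D (suc n) × O D′ n ≡ O D (suc n)
  y′-at-n = upd-upper n _ _ (H D) , upd-upper n _ _ (I D) , upd-upper n _ _ (O D)

  x-at-1+n : H D′ (suc n) ≡ H D n × I D′ (suc n) ≡ I D n × O D′ (suc n) ≡ O D n
  x-at-1+n = upd-lower n _ _ (H D) , upd-lower n _ _ (I D) , upd-lower n _ _ (O D)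

  unchanged : ∀ m → m ≢ n → m ≢ suc n → H D′ m ≡ H D m × I D′ m ≡ I D m × O D′ m ≡ O D m
  unchanged m p q = upd-other n _ _ (H D) m p q , upd-other n _ _ (I D) m p q , upd-other n _ _ (O D) m p q

  passes-as : ∀ m {h i o k k′} → H D′ m ≡ h × I D′ m ≡ i × O D′ m ≡ o →
              Passes h i o k k′ → PassesAt D′ m k k′
  passes-as m (eh , ei , eo) = passes-cong (sym eh) (sym ei) (sym eo)

  module Retraced {a b κ} (tr : EdgeTrace D a b κ) where
    open EdgeTrace tr
    κ′ = retrace D a n κ
    a′ = swapAt n a
    b′ = swapAt n b

    ends-not-exchanged : a ≡ n → b ≡ suc n → ⊥
    ends-not-exchanged refl refl = <⇒≱ leaves-hi (≤-trans (proj₂ adm) enters-lo)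

    passes-x : a < n → suc n < b → PassesAt D n (κ n) (κ (suc n))
    passes-x l₁ l₂ = passes n l₁ (<-trans (n<1+n n) l₂)

    passes-y : a < suc n → suc n < b → PassesAt D (suc n) (κ (suc n)) (κ (suc (suc n)))
    passes-y l₁ l₂ = passes (suc n) l₁ l₂

    commute-at : a < n → suc n < b → Commuted (κ n) (κ (suc n)) (κ (suc (suc n)))
    commute-at l₁ l₂ = commute (passes-x l₁ l₂) (passes-y (<-trans l₁ (n<1+n n)) l₂)

    far-end : a ≡ n → suc n < b
    far-end refl = ≤∧≢⇒< a<b (λ eq → ends-not-exchanged refl (sym eq))

    before-y : b ≡ suc n → a < n
    before-y refl = ≤∧≢⇒< (≤-pred a<b) (λ eq → ends-not-exchanged eq refl)

    κ′-other : ∀ m → m ≢ suc n → κ′ m ≡ κ m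
    κ′-other = retrace-other D a n κ

    a′<n⇒a<n : a′ < n → a < n
    a′<n⇒a<n l with swapView n a
    ... | upper refl rewrite swap-upper n = ⊥-elim (<-asym l (n<1+n n))
    ... | lower refl rewrite swap-lower n = ⊥-elim (<-irrefl refl l)
    ... | other p q rewrite swap-other n a p q = l

    a′<n⇒a≢1+n : a′ < n → a ≢ suc n
    a′<n⇒a≢1+n l refl rewrite swap-lower n = <-irrefl refl l

    1+n<b′⇒1+n<b : suc n < b′ → suc n < b
    1+n<b′⇒1+n<b l with swapView n b
    ... | upper refl rewrite swap-upper n = ⊥-elim (<-irrefl refl l)
    ... | lower refl rewrite swap-lower n = ⊥-elim (<-asym l (n<1+n n))
    ... | other p q rewrite swap-other n b p q = l

    a′<b′ : a′ < b′
    a′<b′ = swap-monotone n a b a<b (λ (p , q) → ends-not-exchanged p q)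

    leaves′ : H D′ a′ ≤ κ′ (suc a′) × κ′ (suc a′) < H D′ a′ + O D′ a′
    leaves′ with swapView n a
    ... | upper refl rewrite swap-upper n | proj₁ x-at-1+n | proj₂ (proj₂ x-at-1+n)
                           | κ′-other (suc (suc n)) (λ ()) =
          let (_ , same) = leaves-x leaves-hi (passes-y (n<1+n n) (far-end refl))
          in subst (H D n ≤_) (sym same) leaves-lo , subst (_< H D n + O D n) (sym same) leaves-hi
    ... | lower refl rewrite swap-lower n | proj₁ y′-at-n | proj₂ (proj₂ y′-at-n)
                           | retrace-up D a n κ refl =
          let (lo , hi , _) = leaves-y leaves-lo leaves-hi in lo , hi
    ... | other p q rewrite swap-other n a p q | proj₁ (unchanged a p q) | proj₂ (proj₂ (unchanged a p q))
                          | κ′-other (suc a) (p ∘ suc-injective) = leaves-lo , leaves-hi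

    enters′ : H D′ b′ ≤ κ′ b′ × κ′ b′ < H D′ b′ + I D′ b′
    enters′ with swapView n b
    ... | upper refl rewrite swap-upper n | proj₁ x-at-1+n | proj₁ (proj₂ x-at-1+n)
                           | retrace-down D a n κ (<⇒≢1+ a<b)
                           | pass↓-left hy′ (I D (suc n)) (O D (suc n)) (enters-x enters-hi) =
          enters-lo , enters-hi
    ... | lower refl rewrite swap-lower n | proj₁ y′-at-n | proj₁ (proj₂ y′-at-n) | κ′-other n n≢1+n =
          let (_ , lo , hi) = enters-y (passes n (before-y refl) (n<1+n n)) enters-lo enters-hi
          in lo , hi
    ... | other p q rewrite swap-other n b p q | proj₁ (unchanged b p q) | proj₁ (proj₂ (unchanged b p q))
                          | κ′-other b q = enters-lo , enters-hi

    passes-y′ : a′ < n → n < b′ → Passes hy′ (I D (suc n)) (O D (suc n)) (κ n) (pass↓ hy′ (I D (suc n)) (O D (suc n)) (κ n))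
    passes-y′ l₁ l₂ with swapView n b
    ... | upper refl = inj₁ (enters-x enters-hi , pass↓-left hy′ (I D (suc n)) (O D (suc n)) (enters-x enters-hi))
    ... | lower refl rewrite swap-lower n = ⊥-elim (<-irrefl refl l₂)
    ... | other p q rewrite swap-other n b p q =
          Commuted.passes-y (commute-at (a′<n⇒a<n l₁) (≤∧≢⇒< l₂ (q ∘ sym)))

    passes-x′ : a′ < suc n → suc n < b′ → Passes (H D n) (I D n) (O D n) (κ′ (suc n)) (κ (suc (suc n)))
    passes-x′ l₁ l₂ with swapView n a
    ... | upper refl rewrite swap-upper n = ⊥-elim (<-irrefl refl l₁)
    ... | lower refl rewrite retrace-up D a n κ refl =
          let (_ , _ , p , _) = leaves-y leaves-lo leaves-hi in p
    ... | other p q rewrite swap-other n a p q | retrace-down D a n κ q =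
          Commuted.passes-x (commute-at (≤∧≢⇒< (≤-pred l₁) p) (1+n<b′⇒1+n<b l₂))

    passes′ : ∀ m → a′ < m → m < b′ → PassesAt D′ m (κ′ m) (κ′ (suc m))
    passes′ m l₁ l₂ with swapView n m
    ... | upper refl rewrite κ′-other n n≢1+n | retrace-down D a n κ (a′<n⇒a≢1+n l₁) =
          passes-as n y′-at-n (passes-y′ l₁ l₂)
    ... | lower refl rewrite κ′-other (suc (suc n)) (λ ()) = passes-as (suc n) x-at-1+n (passes-x′ l₁ l₂)
    ... | other p q rewrite κ′-other m q | κ′-other (suc m) (p ∘ suc-injective) =
          passes-as m (unchanged m p q) (passes m (swap-below n m a p q l₁) (swap-above n m b p q l₂))

    trace′ : EdgeTrace D′ a′ b′ κ′
    trace′ = record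
      { a<b = a′<b′ ; leaves-lo = proj₁ leaves′ ; leaves-hi = proj₂ leaves′ ; passes = passes′
      ; enters-lo = proj₁ enters′ ; enters-hi = proj₂ enters′ }

    side-kept : ∀ h → a < h → h < b → a′ < swapAt n h → swapAt n h < b′ →
                (RightOf D κ h → RightOf D′ κ′ (swapAt n h)) × (RightOf D′ κ′ (swapAt n h) → RightOf D κ h)
    side-kept h l₁ l₂ l₃ l₄ with swapView n h
    ... | other p q rewrite swap-other n h p q | proj₁ (unchanged h p q) | κ′-other h q = (λ r → r) , (λ r → r)
    ... | upper refl rewrite swap-upper n | proj₁ x-at-1+n
                           | retrace-down D a n κ (<⇒≢1+ l₁) =
          let c = commute-at l₁ (1+n<b′⇒1+n<b l₄) in Commuted.left-of-x c , Commuted.left-of-x⁻¹ c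
    ... | lower refl rewrite swap-lower n | proj₁ y′-at-n | κ′-other n n≢1+n =
          let c = commute-at (a′<n⇒a<n l₃) l₂ in Commuted.left-of-y c , Commuted.left-of-y⁻¹ c

    right-downward : a < n → suc n < b → RightOf D κ n → RightOf D κ (suc n)
    right-downward l₁ l₂ = left-of-both (passes-x l₁ l₂)

    enter-below-top : a ≡ suc n → ¬ RightOf D′ κ′ (suc n)
    enter-below-top refl r rewrite proj₁ x-at-1+n | retrace-up D a n κ refl =
      let (_ , _ , _ , x≤) = leaves-y leaves-lo leaves-hi in h+i≤k⇒k≮h x≤ r

    enter-above-bottom : b ≡ n → RightOf D′ κ′ n
    enter-above-bottom refl rewrite proj₁ y′-at-n | κ′-other n n≢1+n = enters-x enters-hi

    leave-above-top : a ≡ n → RightOf D κ (suc n)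
    leave-above-top refl = proj₁ (leaves-x leaves-hi (passes-y (n<1+n n) (far-end refl)))

    leave-below-bottom : b ≡ suc n → ¬ RightOf D κ n
    leave-below-bottom refl r =
      let (x≤ , _ , _) = enters-y (passes n (before-y refl) (n<1+n n)) enters-lo enters-hi
      in h+i≤k⇒k≮h x≤ r

record WireRun (D : Diagram) (m k t : ℕ) : Set where
  field
    κ : ℕ → ℕ
    starts : κ m ≡ k
    m≤t : m ≤ t
    passes : ∀ l → m ≤ l → l < t → PassesAt D l (κ l) (κ (suc l))
    enters-lo : H D t ≤ κ t
    enters-hi : κ t < H D t + I D t

prepend : ∀ {D m k k′ t} → PassesAt D m k k′ → WireRun D (suc m) k′ t → WireRun D m k t
prepend {D} {m} {k} {k′} {t} p run = record
  { κ = κ′ ; starts = κ′-at-m ; m≤t = <⇒≤ m<t ; passes = passes′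
  ; enters-lo = subst (H D t ≤_) (sym (κ′-other t m≢t)) enters-lo
  ; enters-hi = subst (_< H D t + I D t) (sym (κ′-other t m≢t)) enters-hi }
  where
  open WireRun run
  m<t : m < t
  m<t = m≤t
  m≢t : m ≢ t
  m≢t refl = <-irrefl refl m<t
  κ′ : ℕ → ℕ
  κ′ x = if ⌊ x ≟ m ⌋ then k else κ x
  κ′-at-m : κ′ m ≡ k
  κ′-at-m with m ≟ m
  ... | yes _ = refl
  ... | no ne = ⊥-elim (ne refl)
  κ′-other : ∀ x → m ≢ x → κ′ x ≡ κ x
  κ′-other x ne with x ≟ m
  ... | yes e = ⊥-elim (ne (sym e))
  ... | no _ = refl
  passes′ : ∀ l → m ≤ l → l < t → PassesAt D l (κ′ l) (κ′ (suc l))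
  passes′ l m≤l l<t with m ≟ l
  ... | yes refl rewrite κ′-at-m | κ′-other (suc m) n≢1+n = subst (PassesAt D m k) (sym starts) p
  ... | no ne rewrite κ′-other l ne | κ′-other (suc l) (λ e → 1+n≰n (subst (_≤ l) e m≤l)) =
        passes l (≤∧≢⇒< m≤l ne) l<t

wire-run : ∀ D f m k t → go D f m k ≡ just t → WireRun D m k t
wire-run D zero m k t ()
wire-run D (suc f) m k t eq with k <? H D m | k <? H D m + I D m
... | yes k<h | _ = prepend (inj₁ (k<h , refl)) (wire-run D f (suc m) k t eq)
... | no k≮h | no k≮h+i =
      prepend (inj₂ (≮⇒≥ k≮h+i , shifted (H D m) (I D m) (O D m) (≮⇒≥ k≮h+i))) (wire-run D f (suc m) _ t eq)
... | no k≮h | yes k<h+i with eq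
...   | refl = record { κ = λ _ → k ; starts = refl ; m≤t = ≤-refl
                      ; passes = λ l m≤l l<m → ⊥-elim (<⇒≱ l<m m≤l)
                      ; enters-lo = ≮⇒≥ k≮h ; enters-hi = k<h+i }

edge-trace : ∀ D s j t → IsEdge D (s , j) t → Σ (ℕ → ℕ) λ κ → EdgeTrace D s t κ
edge-trace D s j t (_ , lo , hi , reaches) = κ , record
  { a<b = m≤t
  ; leaves-lo = subst (H D s ≤_) (sym starts) lo
  ; leaves-hi = subst (_< H D s + O D s) (sym starts) hi
  ; passes = passes
  ; enters-lo = enters-lo ; enters-hi = enters-hi }
  where open WireRun (wire-run D (N D ∸ suc s) (suc s) j t reaches)

stage-suc : ∀ D ns i → i < length ns → stage D ns (suc i) ≡ rex (stage D ns i) (lookupℕ ns i)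
stage-suc D (x ∷ xs) zero _ = refl
stage-suc D (x ∷ xs) (suc i) (s≤s l) = stage-suc (rex D x) xs i l

height-suc : ∀ ns i u → i < length ns → height ns (suc i) u ≡ swapAt (lookupℕ ns i) (height ns i u)
height-suc (x ∷ xs) zero u _ = refl
height-suc (x ∷ xs) (suc i) u (s≤s l) = height-suc xs i (swapAt x u) l

admissible-at : ∀ D ns i → AdmissibleSeq D ns → i < length ns → Admissible (stage D ns i) (lookupℕ ns i)
admissible-at D (x ∷ xs) zero (adm , _) _ = adm
admissible-at D (x ∷ xs) (suc i) (_ , adms) (s≤s l) = admissible-at (rex D x) xs i adms l

N-stage : ∀ D ns i → N (stage D ns i) ≡ N D
N-stage D ns i = N-run (take i ns) D
  where
  N-run : ∀ xs D → N (run D xs) ≡ N D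
  N-run [] D = refl
  N-run (x ∷ xs) D = N-run xs (rex D x)

height-injective : ∀ ns i u v → height ns i u ≡ height ns i v → u ≡ v
height-injective ns i = injective (take i ns)
  where
  injective : ∀ xs u v → posAfter xs u ≡ posAfter xs v → u ≡ v
  injective [] u v e = e
  injective (x ∷ xs) u v e = swap-injective x u v (injective xs _ _ e)

height-surjective : ∀ ns i h → Σ ℕ λ u → height ns i u ≡ h
height-surjective ns i = surjective (take i ns)
  where
  surjective : ∀ xs h → Σ ℕ λ u → posAfter xs u ≡ h
  surjective [] h = h , refl
  surjective (x ∷ xs) h with surjective xs h
  ... | u , e = swapAt x u , trans (cong (posAfter xs) (swap-involutive x u)) e

swap-fixed : ∀ M n x → suc (suc n) ≤ M → M ≤ x → swapAt n x ≡ x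
swap-fixed M n x l le = swap-other n x (λ { refl → <⇒≱ (<-trans (n<1+n n) l) le })
                                       (λ { refl → <⇒≱ l le })

swap-bounded : ∀ M n x → suc (suc n) ≤ M → x < M → swapAt n x < M
swap-bounded M n x l x<M with swapView n x
... | upper refl rewrite swap-upper n = l
... | lower refl rewrite swap-lower n = <-trans (n<1+n n) x<M
... | other p q rewrite swap-other n x p q = x<M

height-fixed : ∀ D ns i u → AdmissibleSeq D ns → N D ≤ u → height ns i u ≡ u
height-fixed D [] zero u _ _ = refl
height-fixed D [] (suc i) u _ _ = refl
height-fixed D (x ∷ xs) zero u _ _ = refl
height-fixed D (x ∷ xs) (suc i) u ((l , _) , adms) le
  rewrite swap-fixed (N D) x u l le = height-fixed (rex D x) xs i u adms le

height-bounded : ∀ D ns i u → AdmissibleSeq D ns → u < N D → height ns i u < N D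
height-bounded D [] zero u _ l = l
height-bounded D [] (suc i) u _ l = l
height-bounded D (x ∷ xs) zero u _ l = l
height-bounded D (x ∷ xs) (suc i) u ((adm , _) , adms) l =
  height-bounded (rex D x) xs i (swapAt x u) adms (swap-bounded (N D) x u adm l)

FinalPair : ℕ → (ℕ → ℕ) → ℕ → ℕ → Set
FinalPair M ν T B = (T ≡ ν (M ∸ 2) × B ≡ ν (M ∸ 1)) ⊎ (T ≡ ν (M ∸ 1) × B ≡ ν (M ∸ 2))

one-of-pair : ∀ {T B x y f : ℕ} → (T ≡ x × B ≡ y) ⊎ (T ≡ y × B ≡ x) → f ≡ x ⊎ f ≡ y → f ≡ T ⊎ f ≡ B
one-of-pair (inj₁ (refl , refl)) e = e
one-of-pair (inj₂ (refl , refl)) e = Sum.swap e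

between-pair : ∀ {T B x y h : ℕ} (p : ℕ → ℕ) → (T ≡ x × B ≡ y) ⊎ (T ≡ y × B ≡ x) →
               p T ≤ h → h ≤ p B → Between (p x) (p y) h
between-pair p (inj₁ (refl , refl)) l₁ l₂ = inj₁ (l₁ , l₂)
between-pair p (inj₂ (refl , refl)) l₁ l₂ = inj₂ (l₁ , l₂)

module Tracking (A : Diagram) (ns : List ℕ) (adms : AdmissibleSeq A ns)
                (T B : ℕ) (κ₀ : ℕ → ℕ) (trace₀ : EdgeTrace A T B κ₀) where
  k : ℕ
  k = length ns

  D : ℕ → Diagram
  D = stage A ns

  pos : ℕ → ℕ → ℕ
  pos = height ns

  at : ℕ → ℕ
  at = lookupℕ ns

  κ : ℕ → ℕ → ℕ
  κ zero = κ₀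
  κ (suc i) = retrace (D i) (pos i T) (at i) (κ i)

  trace : ∀ i → i ≤ k → EdgeTrace (D i) (pos i T) (pos i B) (κ i)
  trace zero _ = trace₀
  trace (suc i) l rewrite stage-suc A ns i l | height-suc ns i T l | height-suc ns i B l =
    AtExchange.Retraced.trace′ (D i) (at i) (admissible-at A ns i adms l) (trace i (<⇒≤ l))

  Right : ℕ → ℕ → Set
  Right i x = RightOf (D i) (κ i) (pos i x)

  Inside : ℕ → ℕ → Set
  Inside i x = pos i T < pos i x × pos i x < pos i B

  module Step {i : ℕ} (l : i < k) where
    open AtExchange (D i) (at i) (admissible-at A ns i adms l)
    open Retraced (trace i (<⇒≤ l))

    Right-suc : ∀ x → Right (suc i) x ≡ RightOf D′ κ′ (swapAt (at i) (pos i x))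
    Right-suc x rewrite stage-suc A ns i l | height-suc ns i x l = refl

    pos-suc : ∀ x → pos (suc i) x ≡ swapAt (at i) (pos i x)
    pos-suc x = height-suc ns i x l

    kept : ∀ x → Inside i x → Inside (suc i) x →
           (Right i x → Right (suc i) x) × (Right (suc i) x → Right i x)
    kept x (l₁ , l₂) (l₃ , l₄) rewrite Right-suc x =
      side-kept (pos i x) l₁ l₂ (subst₂ _<_ (pos-suc T) (pos-suc x) l₃)
                                (subst₂ _<_ (pos-suc x) (pos-suc B) l₄)

    downward : ∀ x y → pos i x ≡ at i → pos i y ≡ suc (at i) → Inside i x → Inside i y →
               Right i x → Right i y
    downward x y ex ey (Tx , _) (_ , yB) rewrite ex | ey = right-downward Tx yB

    enter-below-T : ∀ x → pos i x ≡ at i → pos i T ≡ suc (at i) → ¬ Right (suc i) x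
    enter-below-T x ex eT rewrite Right-suc x | ex | swap-upper (at i) = enter-below-top eT

    enter-above-B : ∀ x → pos i B ≡ at i → pos i x ≡ suc (at i) → Right (suc i) x
    enter-above-B x eB ex rewrite Right-suc x | ex | swap-lower (at i) = enter-above-bottom eB

    leave-above-T : ∀ x → pos i T ≡ at i → pos i x ≡ suc (at i) → Right i x
    leave-above-T x eT ex rewrite ex = leave-above-top eT

    leave-below-B : ∀ x → pos i x ≡ at i → pos i B ≡ suc (at i) → ¬ Right i x
    leave-below-B x ex eB rewrite ex = leave-below-bottom eB

  Ex : ℕ → ℕ → ℕ → Set
  Ex i a b = i < k × pos i a ≡ at i × pos i b ≡ suc (at i)

  moves-down : ∀ {i x} → i < k → pos i x ≡ at i → pos (suc i) x ≡ suc (at i)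
  moves-down {i} {x} l e = trans (height-suc ns i x l) (trans (cong (swapAt (at i)) e) (swap-upper (at i)))

  moves-up : ∀ {i x} → i < k → pos i x ≡ suc (at i) → pos (suc i) x ≡ at i
  moves-up {i} {x} l e = trans (height-suc ns i x l) (trans (cong (swapAt (at i)) e) (swap-lower (at i)))

  order-kept : ∀ {i a b} → i < k → pos i a < pos i b → ¬ Ex i a b → pos (suc i) a < pos (suc i) b
  order-kept {i} {a} {b} l ab notEx rewrite height-suc ns i a l | height-suc ns i b l =
    swap-monotone (at i) _ _ ab (λ (ea , eb) → notEx (l , ea , eb))

  order-kept⁻¹ : ∀ {i a b} → i < k → pos (suc i) a < pos (suc i) b → ¬ Ex i b a → pos i a < pos i b
  order-kept⁻¹ {i} {a} {b} l ab notEx =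
    subst₂ _<_ (back a) (back b) (swap-monotone (at i) _ _ ab exchanged)
    where
    back : ∀ x → swapAt (at i) (pos (suc i) x) ≡ pos i x
    back x = trans (cong (swapAt (at i)) (height-suc ns i x l)) (swap-involutive (at i) (pos i x))
    exchanged : ¬ (pos (suc i) a ≡ at i × pos (suc i) b ≡ suc (at i))
    exchanged (ea , eb) = notEx (l , trans (sym (back b)) (trans (cong (swapAt (at i)) eb) (swap-lower (at i))) ,
                                     trans (sym (back a)) (trans (cong (swapAt (at i)) ea) (swap-upper (at i))))

  no-height-between : ∀ {n a b c} → a ≡ n → b ≡ suc n → a < c → c < b → ⊥
  no-height-between refl refl a<c c<b = <⇒≱ c<b a<c

  exchanged-vertex : ∀ {i a} → i < k → pos i a ≡ at i ⊎ pos i a ≡ suc (at i) → a < N A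
  exchanged-vertex {i} {a} l e with a <? N A
  ... | yes a<M = a<M
  ... | no a≮M = ⊥-elim (<⇒≱ (≤-trans (s≤s (at≤ e)) room) M≤a)
    where
    M≤a = ≮⇒≥ a≮M
    room : suc (suc (at i)) ≤ N A
    room = subst (suc (suc (at i)) ≤_) (N-stage A ns i) (proj₁ (admissible-at A ns i adms l))
    at≤ : pos i a ≡ at i ⊎ pos i a ≡ suc (at i) → a ≤ suc (at i)
    at≤ e′ rewrite height-fixed A ns i a adms M≤a with e′
    ... | inj₁ refl = n≤1+n a
    ... | inj₂ refl = ≤-refl

  module AsFrame (ν : ℕ → ℕ) (fun : Funnel (N A) ν ns)
                 (ends : FinalPair (N A) ν T B)
                 (B<M : B < N A) where
    M = N A

    T-final : IsFinal M ν T
    T-final = Sum.map proj₁ proj₁ ends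

    B-final : IsFinal M ν B
    B-final = Sum.swap (Sum.map proj₂ proj₂ ends)

    final-is-end : ∀ {f} → IsFinal M ν f → f ≡ T ⊎ f ≡ B
    final-is-end = one-of-pair ends

    non-final : ∀ {u} → u < M → u ≢ T × u ≢ B → NonFinal M ν u
    non-final u<M (u≢T , u≢B) = u<M , Sum.[ u≢T , u≢B ]′ ∘ final-is-end

    meets⇒exchanges : ∀ {i u f} → u ≢ f → Ex i u f ⊎ Ex i f u → Exchanges M ns i u f
    meets⇒exchanges u≢f (inj₁ (l , eu , ef)) =
      l , exchanged-vertex l (inj₁ eu) , exchanged-vertex l (inj₂ ef) , u≢f , inj₁ eu , inj₂ ef
    meets⇒exchanges u≢f (inj₂ (l , ef , eu)) =
      l , exchanged-vertex l (inj₂ eu) , exchanged-vertex l (inj₁ ef) , u≢f , inj₂ eu , inj₁ ef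

    exchanges⇒meets : ∀ {i u f} → Exchanges M ns i u f → Ex i u f ⊎ Ex i f u
    exchanges⇒meets {i} {u} {f} (l , _ , _ , u≢f , iu , if) with iu | if
    ... | inj₁ eu | inj₂ ef = inj₁ (l , eu , ef)
    ... | inj₂ eu | inj₁ ef = inj₂ (l , ef , eu)
    ... | inj₁ eu | inj₁ ef = ⊥-elim (u≢f (height-injective ns i u f (trans eu (sym ef))))
    ... | inj₂ eu | inj₂ ef = ⊥-elim (u≢f (height-injective ns i u f (trans eu (sym ef))))

    crossing : ∀ {i u} → u ≢ T × u ≢ B → (Ex i u T ⊎ Ex i T u) ⊎ (Ex i u B ⊎ Ex i B u) →
               Σ ℕ λ f → IsFinal M ν f × Exchanges M ns i u f
    crossing (u≢T , _) (inj₁ m) = T , T-final , meets⇒exchanges u≢T m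
    crossing (_ , u≢B) (inj₂ m) = B , B-final , meets⇒exchanges u≢B m

    crosses-once : ∀ {u i j} → u ≢ T × u ≢ B →
      (Ex i u T ⊎ Ex i T u) ⊎ (Ex i u B ⊎ Ex i B u) → (Ex j u T ⊎ Ex j T u) ⊎ (Ex j u B ⊎ Ex j B u) → i ≡ j
    crosses-once {u} {i} {j} ou c c′ with crossing ou c | crossing ou c′
    ... | f , F , ex | f′ , F′ , ex′ = proj₁ fun u i j f f′ (non-final (proj₁ (proj₂ ex)) ou) F F′ ex ex′

    crosses-pair : ∀ {i u w} → u ≢ T × u ≢ B → w ≢ T × w ≢ B → Ex i w u →
      (∃ (λ j → Ex j u T ⊎ Ex j T u) × ∃ (λ j → Ex j w B ⊎ Ex j B w)) ⊎
      (∃ (λ j → Ex j u B ⊎ Ex j B u) × ∃ (λ j → Ex j w T ⊎ Ex j T w))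
    crosses-pair {i} {u} {w} ou ow e@(l , ew , eu)
      with proj₂ fun i u w (non-final u<M ou) (non-final w<M ow) (meets⇒exchanges u≢w (inj₂ e))
      where
      u<M = exchanged-vertex l (inj₂ eu)
      w<M = exchanged-vertex l (inj₁ ew)
      u≢w : u ≢ w
      u≢w refl = n≢1+n (trans (sym ew) eu)
    ... | i₁ , i₂ , f₁ , f₂ , F₁ , F₂ , f₁≢f₂ , ex₁ , ex₂ with final-is-end F₁ | final-is-end F₂
    ...   | inj₁ refl | inj₂ refl = inj₁ ((i₁ , exchanges⇒meets ex₁) , (i₂ , exchanges⇒meets ex₂))
    ...   | inj₂ refl | inj₁ refl = inj₂ ((i₁ , exchanges⇒meets ex₁) , (i₂ , exchanges⇒meets ex₂))
    ...   | inj₁ refl | inj₁ refl = ⊥-elim (f₁≢f₂ refl)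
    ...   | inj₂ refl | inj₂ refl = ⊥-elim (f₁≢f₂ refl)

    frame : Frame
    frame = record
      { k = k
      ; Above = λ i a b → pos i a < pos i b
      ; Ex = Ex
      ; above-irrefl = <-irrefl refl
      ; above-trans = <-trans
      ; ex-dec = λ i a b → (i <? k) ×-dec (pos i a ≟ at i) ×-dec (pos i b ≟ suc (at i))
      ; ex-bound = proj₁
      ; ex-before = λ (_ , ea , eb) → subst₂ _<_ (sym ea) (sym eb) (n<1+n _)
      ; ex-after = λ (l , ea , eb) → subst₂ _<_ (sym (moves-up l eb)) (sym (moves-down l ea)) (n<1+n _)
      ; adjacent-before = λ (_ , ea , eb) ac cb → no-height-between ea eb ac cb
      ; adjacent-after = λ (l , ea , eb) bc ca → no-height-between (moves-up l eb) (moves-down l ea) bc ca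
      ; stays-fwd = order-kept
      ; stays-bwd = order-kept⁻¹
      ; T = T
      ; B = B
      ; T-above-B = λ l → EdgeTrace.a<b (trace _ l)
      ; Right = Right
      ; right-fwd = λ l ins ins′ → proj₁ (Step.kept l _ ins ins′)
      ; right-bwd = λ l ins ins′ → proj₂ (Step.kept l _ ins ins′)
      ; right-down = λ (l , ex , ey) insx insy _ _ → Step.downward l _ _ ex ey insx insy
      ; cross-T-down = λ (l , eu , eT) → Step.enter-below-T l _ eu eT
      ; cross-T-up = λ (l , eT , eu) → Step.leave-above-T l _ eT eu
      ; cross-B-up = λ (l , eB , eu) → Step.enter-above-B l _ eB eu
      ; cross-B-down = λ (l , eu , eB) → Step.leave-below-B l _ eu eB
      ; cross-once = crosses-once
      ; cross-pair = crosses-pair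
      }

    ordinary : ∀ {u} → NonFinal M ν u → u ≢ T × u ≢ B
    ordinary (_ , nf) = (λ { refl → nf T-final }) , (λ { refl → nf B-final })

    collapsible : ∀ {c} → CollapsibleAt M ν ns c → Frame.Collapsible frame c
    collapsible {c} coll w ow with w <? M
    ... | no w≮M = inj₂ (<-≤-trans (height-bounded A ns c B adms B<M)
                                   (subst (M ≤_) (sym (height-fixed A ns c w adms (≮⇒≥ w≮M))) (≮⇒≥ w≮M)))
    ... | yes w<M with pos c w <? pos c T | pos c B <? pos c w
    ...   | yes wT | _ = inj₁ wT
    ...   | no _ | yes Bw = inj₂ Bw
    ...   | no w≮T | no B≮w = ⊥-elim (proj₂ (non-final w<M ow)
            (coll w w<M (between-pair (pos c) ends (≮⇒≥ w≮T) (≮⇒≥ B≮w))))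

  only-sinks : ∀ {u} → (∀ i w → ¬ Ex i w u) → ∀ i → i < k → pos i u ≤ pos (suc i) u
  only-sinks {u} never i l with swapView (at i) (pos i u)
  ... | upper e = subst₂ _≤_ (sym e) (sym (moves-down l e)) (n≤1+n _)
  ... | lower e = let (w , ew) = height-surjective ns i (at i) in ⊥-elim (never i w (l , ew , e))
  ... | other p q = ≤-reflexive (sym (trans (height-suc ns i u l) (swap-other (at i) _ p q)))

  only-rises : ∀ {u} → (∀ i w → ¬ Ex i u w) → ∀ i → i < k → pos (suc i) u ≤ pos i u
  only-rises {u} never i l with swapView (at i) (pos i u)
  ... | upper e = let (w , ew) = height-surjective ns i (suc (at i)) in ⊥-elim (never i w (l , e , ew))
  ... | lower e = subst₂ _≤_ (sym (moves-up l e)) (sym e) (n≤1+n _)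
  ... | other p q = ≤-reflexive (trans (height-suc ns i u l) (swap-other (at i) _ p q))

record FinalEdge (A : Diagram) (ν : ℕ → ℕ) : Set where
  field
    T B : ℕ
    κ : ℕ → ℕ
    trace : EdgeTrace A T B κ
    ends : FinalPair (N A) ν T B
    B<M : B < N A

last-two : ∀ M → 2 ≤ M → suc (M ∸ 2) ≡ M ∸ 1 × M ∸ 2 < M × M ∸ 1 < M
last-two (suc (suc m)) (s≤s (s≤s z≤n)) = refl , <-trans (n<1+n m) (n<1+n (suc m)) , n<1+n (suc m)

final-edge : ∀ A ν → PathNumbering A ν → 2 ≤ N A → FinalEdge A ν
final-edge A ν pn two
  with last-two (N A) two
... | next , M∸2<M , M∸1<M
  with PathNumbering.adjacent pn (N A ∸ 2) (subst (_< N A) (sym next) M∸1<M)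
...   | (s , j) , t , edge , joins = record
  { T = s ; B = t ; κ = proj₁ trace₀ ; trace = proj₂ trace₀ ; ends = ends ; B<M = t<M ends }
  where
  trace₀ = edge-trace A s j t edge
  ends : FinalPair (N A) ν s t
  ends = subst (λ q → (s ≡ ν (N A ∸ 2) × t ≡ ν q) ⊎ (s ≡ ν q × t ≡ ν (N A ∸ 2))) next joins
  t<M : FinalPair (N A) ν s t → t < N A
  t<M (inj₁ (_ , refl)) = PathNumbering.inRange pn _ M∸1<M
  t<M (inj₂ (_ , refl)) = PathNumbering.inRange pn _ M∸2<M

-- Lemma 2.4: trace the final edge through the reduction, view the reduction
-- as a frame and apply `steady`.  Linearity enters through the path numbering.
lemma24 : (A : Diagram) (ν : ℕ → ℕ) (ns : List ℕ) →
    IsLinear A → PathNumbering A ν → 2 ≤ N A →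
    AdmissibleSeq A ns → Funnel (N A) ν ns →
    (CollapsibleAt (N A) ν ns 0 ⊎ CollapsibleAt (N A) ν ns (length ns)) →
    ∀ u → NonFinal (N A) ν u → MonotoneHeights ns u
lemma24 A ν ns _ pn two adms fun coll u nf =
  Sum.map (only-sinks {u}) (only-rises {u})
    (steady frame (Sum.map (collapsible {0}) (collapsible {length ns}) coll) (ordinary nf))
  where
  open FinalEdge (final-edge A ν pn two)
  open Tracking A ns adms T B κ trace
  open AsFrame ν fun ends B<M
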